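{- Let $G$ be the grid defined in the context. For every $i\ge0$, the set $\{[G(i,j)]_3 : j\ge0\}$ of base-3 values of the strings in row $i$ equals the set of terms of the sequence $S_i$, the $i$-th sequence of the greedy partition of the non-negative integers into 3-free sequences.
   Context: For a finite string $w=a_na_{n-1}\cdots a_0$ over digits $\{0,1,2\}$ let $[w]_{3/2}=\sum_k a_k(3/2)^k$ and $[w]_3=\sum_k a_k3^k$. Define an operation $T$ on such strings ("adding 2 in base $\frac32$"): if $w$ contains no digit $0$, first replace $w$ by $0w$; then change the rightmost $0$ of $w$ into $2$, change every digit to the right of it by $1\mapsto0$, $2\mapsto1$, and leave all digits to the left of it unchanged. Then $[T(w)]_{3/2}=[w]_{3/2}+2$. The grid $G$ has entries $G(i,j)$ (row $i$, column $j$, $i,j\ge0$): $G(0,j)$ is the binary representation of $j$ (so row $0$ is $0,1,10,11,100,\dots$), and $G(i+1,j)=T(G(i,j))$. A sequence of integers is 3-free if it contains no three distinct terms $x<y<z$ with $y-x=z-y$. $S_0$ is the lexicographically earliest 3-free sequence of non-negative integers: increasing, starting with $0$, each next term the smallest integer larger than the previous one creating no 3-term arithmetic progression with earlier terms. For $n\ge1$, $S_n$ is the lexicographically earliest increasing 3-free sequence of non-negative integers not used in any $S_i$, $i<n$: it starts with the smallest non-negative integer not in $\bigcup_{i<n}S_i$, and each next term is the smallest integer larger than the previous term, not in $\bigcup_{i<n}S_i$, creating no 3-term arithmetic progression with earlier terms of $S_n$. -}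

module Defs where

open import Data.Nat using (ℕ; zero; suc; _+_; _*_; _∸_; _<ᵇ_; _≡ᵇ_)
open import Data.Nat.DivMod using (_/_; _%_)
open import Data.Fin using (Fin; toℕ; fromℕ<)
open import Data.Fin.Patterns using (0F; 1F; 2F)
open import Data.Bool using (Bool; true; false; _∧_; _∨_; not; if_then_else_)
open import Data.List using (List; []; _∷_; _++_; [_])
open import Data.Bool.ListAction using (any)
open import Relation.Binary.PropositionalEquality using (_≡_)

Digit : Set
Digit = Fin 3

-- A digit string a_n ... a_0 is stored LEAST significant digit first:
-- the list  a_0 ∷ a_1 ∷ ... ∷ a_n ∷ [] .
Str : Set
Str = List Digit

val3 : Str → ℕ
val3 []      = 0
val3 (d ∷ w) = toℕ d + 3 * val3 w

-- The operation T ("adding 2 in base 3/2"), lsd-first.  If there is no 0, a leading 0 is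
-- prepended first (the [] case), which then becomes 2.
T : Str → Str
T []       = 2F ∷ []
T (0F ∷ w) = 2F ∷ w
T (1F ∷ w) = 0F ∷ T w
T (2F ∷ w) = 1F ∷ T w

bitsF : ℕ → ℕ → Str
bitsF zero    n = []
bitsF (suc f) zero = []
bitsF (suc f) n@(suc _) = (if (n % 2) ≡ᵇ 0 then 0F else 1F) ∷ bitsF f (n / 2)

binary : ℕ → Str
binary zero = 0F ∷ []
binary j@(suc _) = bitsF j j

G : ℕ → ℕ → Str
G zero    j = binary j
G (suc i) j = T (G i j)

-- does x complete a 3-AP a < b < x with a, b in L (L = earlier terms, all < x)?
makesAP : List ℕ → ℕ → Bool
makesAP L x = any (λ a → any (λ b → (a <ᵇ b) ∧ ((b ∸ a) ≡ᵇ (x ∸ b))) L) L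

termsBelow : List (ℕ → Bool) → ℕ → List ℕ
termsBelow ps zero = []
termsBelow ps (suc b) =
  let L = termsBelow ps b in
  if not (any (λ p → p b) ps) ∧ not (makesAP L b) then L ++ [ b ] else L

memOf : List (ℕ → Bool) → ℕ → Bool
memOf ps x = any (λ y → y ≡ᵇ x) (termsBelow ps (suc x))

prevS : ℕ → List (ℕ → Bool)
prevS zero    = []
prevS (suc n) = prevS n ++ [ memOf (prevS n) ]

inS : ℕ → ℕ → Set
inS n x = memOf (prevS n) x ≡ true

-- Both are described by one function.  Read a ternary string from its most
-- significant digit with ρ(w d) = ⌊(3 ρ(w) + d)/2⌋; it depends only on the
-- value, giving the rank row : ℕ → ℕ with row (d + 3y) = ⌊(3 row y + d)/2⌋.  The proof shows that
-- row i of the grid and S_i are both the rank class {x | row x = i}: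
--   1. ρ (T w) = ρ w + 1, bit strings have rank 0, and conversely every
--      string of rank i+1 (resp. 0) has the value of some T w' with w' of
--      rank i (resp. of a binary numeral).  So grid row i is rank class i.
--   2. No rank class contains a 3-term AP (descent on the last digits).
--   3. If j < row x, x is the last term of a 3-AP inside rank class j
--      (induction on x, via three relaxed kinds of near-APs and a finite
--      table of digit patterns checked by computation).
--   4. By 2 and 3 the greedy construction, given S_0 … S_{n-1} = rank classes
--      0 … n-1, accepts exactly rank class n; induction on n.
module Submission where

open import Defs
open import Data.Nat using (ℕ)
open import Data.Product using (∃-syntax)
open import Function.Bundles using (_⇔_)
open import Relation.Binary.PropositionalEquality using (_≡_)

open import Data.Nat using (zero; suc; _+_; _*_; _∸_; _≤_; _<_; z≤n; s≤s; _≤ᵇ_; _<ᵇ_; _≡ᵇ_; ⌊_/2⌋; NonZero)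
open import Data.Nat.Properties
open import Data.Nat.DivMod using (_/_; _%_; _mod_; _divMod_; DivMod; m/n<m; m%n<n; m≡m%n+[m/n]*n; [m+kn]%n≡m%n; m<n⇒m%n≡m)
open import Data.Nat.Induction using (<-rec)
open import Data.Nat.Tactic.RingSolver using (solve-∀)
open import Data.Fin using (toℕ)
open import Data.Fin.Patterns using (0F; 1F; 2F)
open import Data.Fin.Properties using (toℕ-injective; toℕ<n)
open import Data.Digit using (toDigits; fromDigits)
open import Data.Bool using (Bool; true; false; _∧_; _∨_; if_then_else_) renaming (T to True)
open import Data.Bool.Properties using (T-≡; T-∧; T-∨; ∨-assoc; ∨-zeroʳ)
open import Data.Bool.ListAction using (any)
open import Data.List using (List; []; _∷_; _++_; [_])
open import Data.List.Relation.Unary.All using (All; []; _∷_)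
open import Data.List.Relation.Unary.Any using (here)
open import Data.List.Relation.Unary.Any.Properties using (any⁺; any⁻)
open import Data.List.Membership.Propositional using (_∈_; find; lose)
open import Data.List.Membership.Propositional.Properties using (∈-++⁺ˡ; ∈-++⁺ʳ; ∈-++⁻)
open import Data.Product using (Σ; _×_; _,_; proj₁; proj₂)
open import Data.Sum using (_⊎_; inj₁; inj₂)
open import Data.Empty using (⊥; ⊥-elim)
open import Function.Bundles using (Equivalence; mk⇔)
open import Function.Properties.Equivalence using () renaming (trans to ⇔-trans; sym to ⇔-sym)
open import Relation.Nullary using (¬_; yes; no)
open import Relation.Binary.Definitions using (tri<; tri≈; tri>)
open import Relation.Binary.PropositionalEquality using (_≢_; refl; sym; trans; cong; cong₂; subst; subst₂; module ≡-Reasoning)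

⌊k+k+n/2⌋ : ∀ k n → ⌊ k + k + n /2⌋ ≡ k + ⌊ n /2⌋
⌊k+k+n/2⌋ zero    n = refl
⌊k+k+n/2⌋ (suc k) n rewrite +-suc k k = cong suc (⌊k+k+n/2⌋ k n)

⌊n+2/2⌋ : ∀ n → ⌊ n + 2 /2⌋ ≡ suc ⌊ n /2⌋
⌊n+2/2⌋ n = cong ⌊_/2⌋ (+-comm n 2)

halves : ∀ n → n ≡ ⌊ n /2⌋ + ⌊ n /2⌋ ⊎ n ≡ suc (⌊ n /2⌋ + ⌊ n /2⌋)
halves zero          = inj₁ refl
halves (suc zero)    = inj₂ refl
halves (suc (suc n)) with halves n
... | inj₁ e = inj₁ (cong suc (trans (cong suc e) (sym (+-suc _ _))))
... | inj₂ e = inj₂ (cong suc (trans (cong suc e) (cong suc (sym (+-suc _ _)))))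

≤⌊n/2⌋⇒double≤ : ∀ k n → k ≤ ⌊ n /2⌋ → k + k ≤ n
≤⌊n/2⌋⇒double≤ k n k≤h with halves n
... | inj₁ e = subst (k + k ≤_) (sym e) (+-mono-≤ k≤h k≤h)
... | inj₂ e = subst (k + k ≤_) (sym e) (m≤n⇒m≤1+n (+-mono-≤ k≤h k≤h))

preimages : ∀ {n h} → ⌊ n /2⌋ ≡ h → n ≡ h + h ⊎ n ≡ suc (h + h)
preimages {n} refl = halves n

⌊/2⌋-pigeonhole : ∀ n₁ n₂ n₃ → ⌊ n₁ /2⌋ ≡ ⌊ n₃ /2⌋ → ⌊ n₂ /2⌋ ≡ ⌊ n₃ /2⌋
                → n₁ ≡ n₂ ⊎ n₂ ≡ n₃ ⊎ n₁ ≡ n₃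
⌊/2⌋-pigeonhole n₁ n₂ n₃ e₁ e₂ with preimages {n₁} e₁ | preimages {n₂} e₂ | preimages {n₃} refl
... | inj₁ a | inj₁ b | _      = inj₁ (trans a (sym b))
... | inj₂ a | inj₂ b | _      = inj₁ (trans a (sym b))
... | inj₁ a | inj₂ b | inj₁ c = inj₂ (inj₂ (trans a (sym c)))
... | inj₁ a | inj₂ b | inj₂ c = inj₂ (inj₁ (trans b (sym c)))
... | inj₂ a | inj₁ b | inj₁ c = inj₂ (inj₁ (trans b (sym c)))
... | inj₂ a | inj₁ b | inj₂ c = inj₂ (inj₂ (trans a (sym c)))

mod-cong : ∀ b .{{_ : NonZero b}} p q a a' → p + b * a ≡ q + b * a' → p % b ≡ q % b
mod-cong b p q a a' eq = trans (sym (drop p a)) (trans (cong (_% b) eq) (drop q a'))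
  where
  drop : ∀ p y → (p + b * y) % b ≡ p % b
  drop p y = trans (cong (λ z → (p + z) % b) (*-comm b y)) ([m+kn]%n≡m%n p y b)

place-value-injective : ∀ b .{{_ : NonZero b}} r r' a a' → r < b → r' < b
                      → r + b * a ≡ r' + b * a' → r ≡ r' × a ≡ a'
place-value-injective b r r' a a' r<b r'<b eq =
  r≡r' , *-cancelˡ-≡ a a' b (+-cancelˡ-≡ r _ _ (trans eq (cong (λ z → z + b * a') (sym r≡r'))))
  where
  r≡r' : r ≡ r'
  r≡r' = trans (sym (m<n⇒m%n≡m r<b)) (trans (mod-cong b r r' a a' eq) (m<n⇒m%n≡m r'<b))

digit-injective : ∀ (d d' : Digit) a a' → toℕ d + 3 * a ≡ toℕ d' + 3 * a' → d ≡ d' × a ≡ a'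
digit-injective d d' a a' eq with place-value-injective 3 (toℕ d) (toℕ d') a a' (toℕ<n d) (toℕ<n d') eq
... | r≡r' , a≡a' = toℕ-injective r≡r' , a≡a'

lastDigit : ℕ → Digit
lastDigit x = x mod 3

decompose : ∀ x → x ≡ toℕ (lastDigit x) + 3 * (x / 3)
decompose x = trans (DivMod.property (x divMod 3)) (cong (toℕ (lastDigit x) +_) (*-comm (x / 3) 3))

rest<self : ∀ x → 0 < x → x / 3 < x
rest<self (suc x) _ = m/n<m (suc x) 3 (s≤s (s≤s z≤n))

-- The rank of a digit string: the digits read from the most significant end
-- with the recurrence ρ(w d) = ⌊(3 ρ(w) + d)/2⌋.  It will turn out to be the
-- index of the grid row (and of the greedy sequence) containing [w]₃.
ρ : Str → ℕ
ρ []      = 0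
ρ (d ∷ w) = ⌊ 3 * ρ w + toℕ d /2⌋

ρ-of-zero : ∀ w → val3 w ≡ 0 → ρ w ≡ 0
ρ-of-zero []       _ = refl
ρ-of-zero (0F ∷ w) e rewrite ρ-of-zero w (*-cancelˡ-≡ (val3 w) 0 3 e) = refl

ρ-val3 : ∀ u v → val3 u ≡ val3 v → ρ u ≡ ρ v
ρ-val3 []      v       e = sym (ρ-of-zero v (sym e))
ρ-val3 (d ∷ u) []      e = ρ-of-zero (d ∷ u) e
ρ-val3 (d ∷ u) (d' ∷ v) e with digit-injective d d' (val3 u) (val3 v) e
... | refl , e' rewrite ρ-val3 u v e' = refl

ternary : ℕ → Str
ternary x = proj₁ (toDigits 3 x)

val3-ternary : ∀ x → val3 (ternary x) ≡ x
val3-ternary x = trans (val3≡fromDigits (ternary x)) (proj₂ (toDigits 3 x))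
  where
  val3≡fromDigits : ∀ w → val3 w ≡ fromDigits w
  val3≡fromDigits []      = refl
  val3≡fromDigits (d ∷ w) = cong (toℕ d +_) (trans (*-comm 3 (val3 w)) (cong (_* 3) (val3≡fromDigits w)))

row : ℕ → ℕ
row x = ρ (ternary x)

row-val3 : ∀ w → row (val3 w) ≡ ρ w
row-val3 w = ρ-val3 (ternary (val3 w)) w (val3-ternary (val3 w))

row-step : ∀ (d : Digit) y → row (toℕ d + 3 * y) ≡ ⌊ 3 * row y + toℕ d /2⌋
row-step d y = ρ-val3 (ternary (toℕ d + 3 * y)) (d ∷ ternary y)
  (trans (val3-ternary _) (cong (λ z → toℕ d + 3 * z) (sym (val3-ternary y))))

-- T raises the rank by one: a carry turns digit d+1 into d and raises the
-- rank of the rest by one, which adds 3 - 1 = 2 before halving.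
carry : ∀ r d → 3 * suc r + d ≡ 3 * r + suc d + 2
carry = solve-∀

ρ-T : ∀ w → ρ (T w) ≡ suc (ρ w)
ρ-T []       = refl
ρ-T (0F ∷ w) = trans (⌊n+2/2⌋ (3 * ρ w)) (cong (λ z → suc ⌊ z /2⌋) (sym (+-identityʳ (3 * ρ w))))
ρ-T (1F ∷ w) rewrite ρ-T w = trans (cong ⌊_/2⌋ (carry (ρ w) 0)) (⌊n+2/2⌋ (3 * ρ w + 1))
ρ-T (2F ∷ w) rewrite ρ-T w = trans (cong ⌊_/2⌋ (carry (ρ w) 1)) (⌊n+2/2⌋ (3 * ρ w + 2))

Bit : Digit → Set
Bit d = toℕ d < 2

BitString : Str → Set
BitString = All Bit

-- ⌊(3 ρ + d)/2⌋ = 0 forces 3 ρ + d ∈ {0, 1}, i.e. ρ = 0 and d a bit.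
ρ≡0⇒bits : ∀ w → ρ w ≡ 0 → BitString w
ρ≡0⇒bits []      _ = []
ρ≡0⇒bits (d ∷ w) e with preimages e
... | inj₁ 3ρ+d≡0 with digit-injective d 0F (ρ w) 0 (trans (+-comm (toℕ d) _) 3ρ+d≡0)
...   | refl , ρw≡0 = s≤s z≤n ∷ ρ≡0⇒bits w ρw≡0
ρ≡0⇒bits (d ∷ w) e | inj₂ 3ρ+d≡1 with digit-injective d 1F (ρ w) 0 (trans (+-comm (toℕ d) _) 3ρ+d≡1)
...   | refl , ρw≡0 = s≤s (s≤s z≤n) ∷ ρ≡0⇒bits w ρw≡0

bits⇒ρ≡0 : ∀ {w} → BitString w → ρ w ≡ 0
bits⇒ρ≡0 []                         = refl
bits⇒ρ≡0 {0F ∷ w} (_ ∷ bs) rewrite bits⇒ρ≡0 bs = refl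
bits⇒ρ≡0 {1F ∷ w} (_ ∷ bs) rewrite bits⇒ρ≡0 bs = refl
bits⇒ρ≡0 {2F ∷ w} (s≤s (s≤s ()) ∷ _)

val2 : Str → ℕ
val2 []      = 0
val2 (d ∷ w) = toℕ d + 2 * val2 w

-- Bit strings with the same binary value have the same ternary value
-- (they differ only by leading zeros).
val3-of-zero : ∀ {w} → BitString w → val2 w ≡ 0 → val3 w ≡ 0
val3-of-zero []                   _ = refl
val3-of-zero {0F ∷ w} (_ ∷ bs) e rewrite val3-of-zero bs (*-cancelˡ-≡ (val2 w) 0 2 e) = refl

val2⇒val3 : ∀ {u v} → BitString u → BitString v → val2 u ≡ val2 v → val3 u ≡ val3 v
val2⇒val3 []                 bv        e = sym (val3-of-zero bv (sym e))
val2⇒val3 bu@(_ ∷ _)         []        e = val3-of-zero bu e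
val2⇒val3 {d ∷ u} {d' ∷ v} (b ∷ bu) (b' ∷ bv) e
  with place-value-injective 2 (toℕ d) (toℕ d') (val2 u) (val2 v) b b' e
... | d≡d' , e' rewrite toℕ-injective d≡d' = cong (λ z → toℕ d' + 3 * z) (val2⇒val3 bu bv e')

bit : ℕ → Digit
bit n = if n % 2 ≡ᵇ 0 then 0F else 1F

toℕ-bit : ∀ n → toℕ (bit n) ≡ n % 2
toℕ-bit n with n % 2 | m%n<n n 2
... | 0 | _ = refl
... | 1 | _ = refl
... | suc (suc _) | s≤s (s≤s ())

bitsF-correct : ∀ f n → n ≤ f → BitString (bitsF f n) × val2 (bitsF f n) ≡ n
bitsF-correct zero    zero    _   = [] , refl
bitsF-correct (suc f) zero    _   = [] , refl
bitsF-correct (suc f) (suc n) n≤f with bitsF-correct f (suc n / 2) (≤-pred (≤-trans (m/n<m (suc n) 2 (s≤s (s≤s z≤n))) n≤f))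
... | bs , v = (subst (_< 2) (sym (toℕ-bit (suc n))) (m%n<n (suc n) 2) ∷ bs)
             , trans (cong₂ (λ a b → a + 2 * b) (toℕ-bit (suc n)) v)
                     (trans (cong (suc n % 2 +_) (*-comm 2 (suc n / 2))) (sym (m≡m%n+[m/n]*n (suc n) 2)))

binary-correct : ∀ j → BitString (binary j) × val2 (binary j) ≡ j
binary-correct zero    = (s≤s z≤n ∷ []) , refl
binary-correct (suc j) = bitsF-correct (suc j) (suc j) ≤-refl

ρ-G : ∀ i j → ρ (G i j) ≡ i
ρ-G zero    j = bits⇒ρ≡0 (proj₁ (binary-correct j))
ρ-G (suc i) j = trans (ρ-T (G i j)) (cong suc (ρ-G i j))

val3-T-of-zero : ∀ v → val3 v ≡ 0 → val3 (T v) ≡ 2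
val3-T-of-zero []       _ = refl
val3-T-of-zero (0F ∷ w) e rewrite *-cancelˡ-≡ (val3 w) 0 3 e = refl

val3-T : ∀ u v → val3 u ≡ val3 v → val3 (T u) ≡ val3 (T v)
val3-T []      v       e = sym (val3-T-of-zero v (sym e))
val3-T (d ∷ u) []      e = val3-T-of-zero (d ∷ u) e
val3-T (d ∷ u) (d' ∷ v) e with digit-injective d d' (val3 u) (val3 v) e
... | refl , e' with d
... | 0F = cong (λ z → 2 + 3 * z) e'
... | 1F = cong (λ z → 0 + 3 * z) (val3-T u v e')
... | 2F = cong (λ z → 1 + 3 * z) (val3-T u v e')

rest-positive : ∀ d u → Bit d → 0 < ρ (d ∷ u) → 0 < ρ u
rest-positive d u bd pos = n≢0⇒n>0 (λ ρu≡0 → <⇒≢ pos (sym (bits⇒ρ≡0 (bd ∷ ρ≡0⇒bits u ρu≡0))))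

-- Every string w of positive rank has the value of some T w': reading from
-- the right, undo T by 2 ↦ 0 at the first digit 2, and 0 ↦ 1, 1 ↦ 2 below it.
T-preimage : ∀ w → 0 < ρ w → Σ Str λ w' → val3 (T w') ≡ val3 w
T-preimage (0F ∷ u) pos with T-preimage u (rest-positive 0F u (s≤s z≤n) pos)
... | u' , e = (1F ∷ u') , cong (λ z → 0 + 3 * z) e
T-preimage (1F ∷ u) pos with T-preimage u (rest-positive 1F u (s≤s (s≤s z≤n)) pos)
... | u' , e = (2F ∷ u') , cong (λ z → 1 + 3 * z) e
T-preimage (2F ∷ u) pos = (0F ∷ u) , refl

rank⇒grid : ∀ i w → ρ w ≡ i → ∃[ j ] val3 (G i j) ≡ val3 w
rank⇒grid zero w ρw≡0 =
  val2 w , val2⇒val3 (proj₁ (binary-correct (val2 w))) (ρ≡0⇒bits w ρw≡0) (proj₂ (binary-correct (val2 w)))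
rank⇒grid (suc i) w ρw≡1+i with T-preimage w (subst (0 <_) (sym ρw≡1+i) (s≤s z≤n))
... | w' , Tw'≈w with rank⇒grid i w' (suc-injective (trans (sym (ρ-T w')) (trans (ρ-val3 (T w') w Tw'≈w) ρw≡1+i)))
... | j , Gij≈w' = j , trans (val3-T (G i j) w' Gij≈w') Tw'≈w

grid-row : ∀ i x → (∃[ j ] val3 (G i j) ≡ x) ⇔ row x ≡ i
grid-row i x = mk⇔
  (λ { (j , refl) → trans (row-val3 (G i j)) (ρ-G i j) })
  (λ rowx≡i → let (j , e) = rank⇒grid i (ternary x) rowx≡i in j , trans e (val3-ternary x))

row-step-< : ∀ (d : Digit) {p q} → p < q → ⌊ 3 * p + toℕ d /2⌋ < ⌊ 3 * q + toℕ d /2⌋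
row-step-< d {p} {q} p<q = subst (_≤ ⌊ 3 * q + toℕ d /2⌋) (⌊n+2/2⌋ (3 * p + toℕ d)) (⌊n/2⌋-mono (begin
  3 * p + toℕ d + 2      ≤⟨ n≤1+n _ ⟩
  suc (3 * p + toℕ d + 2) ≡⟨ shift p (toℕ d) ⟩
  3 * suc p + toℕ d      ≤⟨ +-monoˡ-≤ (toℕ d) (*-monoʳ-≤ 3 p<q) ⟩
  3 * q + toℕ d          ∎))
  where
  open ≤-Reasoning
  shift : ∀ p d → suc (3 * p + d + 2) ≡ 3 * suc p + d
  shift = solve-∀

row-step-injective : ∀ (d : Digit) p q → ⌊ 3 * p + toℕ d /2⌋ ≡ ⌊ 3 * q + toℕ d /2⌋ → p ≡ q
row-step-injective d p q e with <-cmp p q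
... | tri< p<q _ _ = ⊥-elim (<-irrefl e (row-step-< d p<q))
... | tri≈ _ p≡q _ = p≡q
... | tri> _ _ q<p = ⊥-elim (<-irrefl (sym e) (row-step-< d q<p))

-- Last digits of a 3-AP a, b, x satisfy a + x ≡ 2b (mod 3): they are all
-- equal or pairwise distinct.
data EqualOrDistinct : Digit → Digit → Digit → Set where
  equal    : ∀ d → EqualOrDistinct d d d
  distinct : ∀ {a b x} → a ≢ b → b ≢ x → a ≢ x → EqualOrDistinct a b x

ap-digits : ∀ (da db dx : Digit) → (toℕ da + toℕ dx) % 3 ≡ (toℕ db + toℕ db) % 3 → EqualOrDistinct da db dx
ap-digits 0F 0F 0F _ = equal 0F
ap-digits 1F 1F 1F _ = equal 1F
ap-digits 2F 2F 2F _ = equal 2F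
ap-digits 0F 1F 2F _ = distinct (λ ()) (λ ()) (λ ())
ap-digits 0F 2F 1F _ = distinct (λ ()) (λ ()) (λ ())
ap-digits 1F 0F 2F _ = distinct (λ ()) (λ ()) (λ ())
ap-digits 1F 2F 0F _ = distinct (λ ()) (λ ()) (λ ())
ap-digits 2F 0F 1F _ = distinct (λ ()) (λ ()) (λ ())
ap-digits 2F 1F 0F _ = distinct (λ ()) (λ ()) (λ ())
ap-digits 0F 0F 1F ()
ap-digits 0F 0F 2F ()
ap-digits 0F 1F 0F ()
ap-digits 0F 1F 1F ()
ap-digits 0F 2F 0F ()
ap-digits 0F 2F 2F ()
ap-digits 1F 0F 0F ()
ap-digits 1F 0F 1F ()
ap-digits 1F 1F 0F ()
ap-digits 1F 1F 2F ()
ap-digits 1F 2F 1F ()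
ap-digits 1F 2F 2F ()
ap-digits 2F 0F 0F ()
ap-digits 2F 0F 2F ()
ap-digits 2F 1F 1F ()
ap-digits 2F 1F 2F ()
ap-digits 2F 2F 0F ()
ap-digits 2F 2F 1F ()

NoAPEndingAt : ℕ → Set
NoAPEndingAt x = ∀ a b → row a ≡ row x → row b ≡ row x → a + x ≡ b + b → a < b → ⊥

collect : ∀ p q u v → (p + 3 * u) + (q + 3 * v) ≡ (p + q) + 3 * (u + v)
collect = solve-∀

digits-of-ap : ∀ da db dx a b x → (da + 3 * a) + (dx + 3 * x) ≡ (db + 3 * b) + (db + 3 * b)
             → (da + dx) + 3 * (a + x) ≡ (db + db) + 3 * (b + b)
digits-of-ap da db dx a b x isAP = trans (sym (collect da dx a x)) (trans isAP (collect db db b b))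

same-rank-rest : ∀ (d : Digit) y z → row (toℕ d + 3 * y) ≡ row (toℕ d + 3 * z) → row y ≡ row z
same-rank-rest d y z e = row-step-injective d (row y) (row z) (trans (sym (row-step d y)) (trans e (row-step d z)))

last-digit-agrees : ∀ (d d' : Digit) p q → 3 * p + toℕ d ≡ 3 * q + toℕ d' → d ≡ d'
last-digit-agrees d d' p q e = proj₁ (digit-injective d d' p q (trans (+-comm (toℕ d) (3 * p)) (trans e (+-comm (3 * q) (toℕ d')))))

-- One descent step: the last digits of a 3-AP inside a rank class are equal
-- (and dropping them leaves a 3-AP inside a rank class) or pairwise distinct,
-- which is impossible since three distinct values 3 ρ + d cannot share a half.
ap-descent : ∀ (da db dx : Digit) a b x → NoAPEndingAt x
           → row (toℕ da + 3 * a) ≡ row (toℕ dx + 3 * x) → row (toℕ db + 3 * b) ≡ row (toℕ dx + 3 * x)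
           → (toℕ da + toℕ dx) + 3 * (a + x) ≡ (toℕ db + toℕ db) + 3 * (b + b)
           → toℕ da + 3 * a < toℕ db + 3 * b → ⊥
ap-descent da db dx a b x noAP ra rb isAP a<b with ap-digits da db dx (mod-cong 3 (toℕ da + toℕ dx) (toℕ db + toℕ db) (a + x) (b + b) isAP)
... | equal d = noAP a b (same-rank-rest d a x ra) (same-rank-rest d b x rb)
                     (*-cancelˡ-≡ _ _ 3 (+-cancelˡ-≡ (toℕ d + toℕ d) _ _ isAP))
                     (*-cancelˡ-< 3 a b (+-cancelˡ-< (toℕ d) _ _ a<b))
... | distinct da≢db db≢dx da≢dx
  with ⌊/2⌋-pigeonhole (3 * row a + toℕ da) (3 * row b + toℕ db) (3 * row x + toℕ dx) (trans (sym (row-step da a)) (trans ra (row-step dx x)))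
                       (trans (sym (row-step db b)) (trans rb (row-step dx x)))
... | inj₁ e        = da≢db (last-digit-agrees da db (row a) (row b) e)
... | inj₂ (inj₁ e) = db≢dx (last-digit-agrees db dx (row b) (row x) e)
... | inj₂ (inj₂ e) = da≢dx (last-digit-agrees da dx (row a) (row x) e)

middle<last : ∀ {a b x} → a + x ≡ b + b → a < b → b < x
middle<last {a} {b} {x} isAP a<b with <-cmp b x
... | tri< b<x _ _ = b<x
... | tri≈ _ refl _ = ⊥-elim (<-irrefl isAP (+-monoˡ-< b a<b))
... | tri> _ _ x<b = ⊥-elim (<-irrefl isAP (+-mono-< a<b x<b))

first<middle : ∀ {a b x} → a + x ≡ b + b → b < x → a < b
first<middle {a} {b} {x} isAP b<x with <-cmp a b
... | tri< a<b _ _ = a<b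
... | tri≈ _ refl _ = ⊥-elim (<-irrefl (sym (+-cancelˡ-≡ a x a isAP)) b<x)
... | tri> _ _ b<a = ⊥-elim (<-irrefl (sym isAP) (+-mono-< b<a b<x))

rank-class-AP-free : ∀ x → NoAPEndingAt x
rank-class-AP-free = <-rec NoAPEndingAt step
  where
  step : ∀ x → (∀ {y} → y < x → NoAPEndingAt y) → NoAPEndingAt x
  step x rec a b ra rb isAP a<b =
    ap-descent (lastDigit a) (lastDigit b) (lastDigit x) (a / 3) (b / 3) (x / 3)
      (rec (rest<self x (≤-<-trans z≤n (middle<last isAP a<b))))
      (subst₂ (λ u v → row u ≡ row v) (decompose a) (decompose x) ra)
      (subst₂ (λ u v → row u ≡ row v) (decompose b) (decompose x) rb)
      (digits-of-ap (toℕ (lastDigit a)) (toℕ (lastDigit b)) (toℕ (lastDigit x)) (a / 3) (b / 3) (x / 3)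
        (subst₂ _≡_ (cong₂ _+_ (decompose a) (decompose x)) (cong₂ _+_ (decompose b) (decompose b)) isAP))
      (subst₂ _<_ (decompose a) (decompose b) a<b)

-- The existence of 3-APs is proved by induction on the ternary
-- digits together with three relaxed companion statements.  A shape fixes
-- the rank offset of b, the defects p, q in  a + x + p = b + b + q, and
-- whether b < x or only b ≤ x is required.
data Kind : Set where
  ap  : Kind   -- a + x = b + b,       row a = row b = j,        b < x
  ap⁺ : Kind   -- a + x + 1 = b + b,   row a = j, row b = j + 1, b ≤ x
  ap⁻ : Kind   -- a + x = b + b + 1,   row a = row b = j,        b < x

data Shape : Set where
  strong : Kind → Shape
  weak   : Shape   -- a + x = b + b,   row a = row b = j,        b ≤ x

-- The parameters of the shapes listed above.  Strong shapes are asked for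
-- ranks j < row x (slack 1), the weak one for j ≤ row x (slack 0).
rise excess deficit slack : Shape → ℕ
rise (strong ap⁺)    = 1
rise _               = 0
excess (strong ap⁺)  = 1
excess _             = 0
deficit (strong ap⁻) = 1
deficit _            = 0
slack (strong _)     = 1
slack weak           = 0

strict : Shape → Bool
strict (strong ap)  = true
strict (strong ap⁺) = false
strict (strong ap⁻) = true
strict weak         = false

Below : Bool → ℕ → ℕ → Set
Below true  b x = b < x
Below false b x = b ≤ x

NearAP : Shape → ℕ → ℕ → Set
NearAP s x j = Σ ℕ λ a → Σ ℕ λ b →
  row a ≡ j × row b ≡ j + rise s × a + x + excess s ≡ b + b + deficit s × Below (strict s) b x

NearAPsBelow : Shape → ℕ → Set
NearAPsBelow s x = ∀ j → j + slack s ≤ row x → NearAP s x j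

-- How to build a near-AP ending at x = dx + 3x' with a at rank r + 3m: take
-- a near-AP of shape `source` ending at x' with a' at rank 2m + offset, and
-- append the digits da, db to a', b'.
record Plan : Set where
  constructor use
  field
    source : Shape
    da db  : Digit
    offset : ℕ

-- The plan for target kind k, last digit dx of x and r = j mod 3.
plan : Kind → Digit → Digit → Plan
plan ap  0F 0F = use (strong ap)  0F 0F 0
plan ap  0F 1F = use (strong ap)  0F 0F 1
plan ap  0F 2F = use (strong ap)  2F 1F 1
plan ap  1F 0F = use (strong ap)  1F 1F 0
plan ap  1F 1F = use (strong ap⁺) 2F 0F 0
plan ap  1F 2F = use (strong ap)  1F 1F 1
plan ap  2F 0F = use weak         0F 1F 0
plan ap  2F 1F = use (strong ap)  2F 2F 0
plan ap  2F 2F = use (strong ap)  2F 2F 1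
plan ap⁺ 0F 0F = use (strong ap⁻) 0F 2F 0
plan ap⁺ 0F 1F = use (strong ap⁻) 0F 2F 1
plan ap⁺ 0F 2F = use (strong ap⁺) 2F 0F 1
plan ap⁺ 1F 0F = use (strong ap⁺) 1F 0F 0
plan ap⁺ 1F 1F = use weak         0F 1F 1
plan ap⁺ 1F 2F = use (strong ap⁺) 1F 0F 1
plan ap⁺ 2F 0F = use weak         1F 2F 0
plan ap⁺ 2F 1F = use (strong ap⁺) 2F 1F 0
plan ap⁺ 2F 2F = use (strong ap⁺) 2F 1F 1
plan ap⁻ 0F 0F = use (strong ap)  1F 0F 0
plan ap⁻ 0F 1F = use (strong ap⁻) 2F 2F 0
plan ap⁻ 0F 2F = use (strong ap⁻) 2F 2F 1
plan ap⁻ 1F 0F = use (strong ap)  0F 0F 0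
plan ap⁻ 1F 1F = use weak         0F 0F 1
plan ap⁻ 1F 2F = use (strong ap)  2F 1F 1
plan ap⁻ 2F 0F = use weak         1F 1F 0
plan ap⁻ 2F 1F = use (strong ap⁺) 2F 0F 0
plan ap⁻ 2F 2F = use (strong ap)  1F 1F 1

-- When does b' R' x' imply (db + 3b') R (dx + 3x')?  Always if R' is <;
-- otherwise the last digits have to be compared.
orderLifts : Bool → Bool → Digit → Digit → Bool
orderLifts true  _     _  _  = true
orderLifts false true  db dx = toℕ db <ᵇ toℕ dx
orderLifts false false db dx = toℕ db ≤ᵇ toℕ dx

-- The conditions under which a plan works for target shape s, each a
-- decidable check: the appended digits give a and b the right ranks and
-- balance the AP equation, the order of b and x lifts, and the rank needed
-- at x' is available whenever the rank asked for at x is.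
Fits : Shape → Digit → Digit → Plan → Set
Fits s dx r (use s' da db e) =
    True (⌊ 3 * e + toℕ da /2⌋ ≡ᵇ toℕ r)
  × True (⌊ 3 * (e + rise s') + toℕ db /2⌋ ≡ᵇ toℕ r + rise s)
  × True (toℕ da + toℕ dx + excess s + 3 * deficit s' ≡ᵇ toℕ db + toℕ db + deficit s + 3 * excess s')
  × True (orderLifts (strict s') (strict s) db dx)
  × True (3 * (e + slack s') + toℕ dx ≤ᵇ (toℕ r + slack s) + (toℕ r + slack s) + 2)

digitwise : ∀ {P : Digit → Set} → P 0F → P 1F → P 2F → ∀ d → P d
digitwise p₀ p₁ p₂ 0F = p₀
digitwise p₀ p₁ p₂ 1F = p₁
digitwise p₀ p₁ p₂ 2F = p₂

plan-fits : ∀ k dx r → Fits (strong k) dx r (plan k dx r)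
plan-fits ap  0F = digitwise _ _ _
plan-fits ap  1F = digitwise _ _ _
plan-fits ap  2F = digitwise _ _ _
plan-fits ap⁺ 0F = digitwise _ _ _
plan-fits ap⁺ 1F = digitwise _ _ _
plan-fits ap⁺ 2F = digitwise _ _ _
plan-fits ap⁻ 0F = digitwise _ _ _
plan-fits ap⁻ 1F = digitwise _ _ _
plan-fits ap⁻ 2F = digitwise _ _ _

append-< : ∀ (db dx : Digit) {b x} → b < x → toℕ db + 3 * b < toℕ dx + 3 * x
append-< db dx {b} {x} b<x = begin-strict
  toℕ db + 3 * b   <⟨ +-monoˡ-< (3 * b) (toℕ<n db) ⟩
  3 + 3 * b        ≡⟨ *-suc 3 b ⟨
  3 * suc b        ≤⟨ *-monoʳ-≤ 3 b<x ⟩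
  3 * x            ≤⟨ m≤n+m (3 * x) (toℕ dx) ⟩
  toℕ dx + 3 * x   ∎
  where open ≤-Reasoning

below-lift : ∀ σ' σ (db dx : Digit) {b x} → True (orderLifts σ' σ db dx)
           → Below σ' b x → Below σ (toℕ db + 3 * b) (toℕ dx + 3 * x)
below-lift true  true  db dx _  b<x = append-< db dx b<x
below-lift true  false db dx _  b<x = <⇒≤ (append-< db dx b<x)
below-lift false true  db dx ok b≤x = +-mono-<-≤ (<ᵇ⇒< (toℕ db) (toℕ dx) ok) (*-monoʳ-≤ 3 b≤x)
below-lift false false db dx ok b≤x = +-mono-≤ (≤ᵇ⇒≤ (toℕ db) (toℕ dx) ok) (*-monoʳ-≤ 3 b≤x)

+-swap-last : ∀ u v w → u + v + w ≡ u + w + v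
+-swap-last = solve-∀

rank-append : ∀ m e (d : Digit) t → ⌊ 3 * e + toℕ d /2⌋ ≡ t → ⌊ 3 * (2 * m + e) + toℕ d /2⌋ ≡ t + 3 * m
rank-append m e d t h = begin
  ⌊ 3 * (2 * m + e) + toℕ d /2⌋           ≡⟨ cong ⌊_/2⌋ (split m e (toℕ d)) ⟩
  ⌊ 3 * m + 3 * m + (3 * e + toℕ d) /2⌋   ≡⟨ ⌊k+k+n/2⌋ (3 * m) _ ⟩
  3 * m + ⌊ 3 * e + toℕ d /2⌋             ≡⟨ cong (3 * m +_) h ⟩
  3 * m + t                               ≡⟨ +-comm (3 * m) t ⟩
  t + 3 * m                               ∎
  where
  open ≡-Reasoning
  split : ∀ m e d → 3 * (2 * m + e) + d ≡ 3 * m + 3 * m + (3 * e + d)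
  split = solve-∀

near-lift : ∀ s dx r P → Fits s dx r P → ∀ x' m
          → NearAP (Plan.source P) x' (2 * m + Plan.offset P)
          → NearAP s (toℕ dx + 3 * x') (toℕ r + 3 * m)
near-lift s dx r (use s' da db e) (rank-a , rank-b , balance , order , _) x' m (a' , b' , ra' , rb' , isAP' , b'x') =
  toℕ da + 3 * a' , toℕ db + 3 * b' , row-a , row-b , balanced , below-lift (strict s') (strict s) db dx order b'x'
  where
  open ≡-Reasoning
  row-a : row (toℕ da + 3 * a') ≡ toℕ r + 3 * m
  row-a = begin
    row (toℕ da + 3 * a')          ≡⟨ row-step da a' ⟩
    ⌊ 3 * row a' + toℕ da /2⌋      ≡⟨ cong (λ z → ⌊ 3 * z + toℕ da /2⌋) ra' ⟩
    ⌊ 3 * (2 * m + e) + toℕ da /2⌋ ≡⟨ rank-append m e da (toℕ r) (≡ᵇ⇒≡ _ _ rank-a) ⟩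
    toℕ r + 3 * m                  ∎
  row-b : row (toℕ db + 3 * b') ≡ toℕ r + 3 * m + rise s
  row-b = begin
    row (toℕ db + 3 * b')                          ≡⟨ row-step db b' ⟩
    ⌊ 3 * row b' + toℕ db /2⌋                      ≡⟨ cong (λ z → ⌊ 3 * z + toℕ db /2⌋) (trans rb' (+-assoc (2 * m) e (rise s'))) ⟩
    ⌊ 3 * (2 * m + (e + rise s')) + toℕ db /2⌋     ≡⟨ rank-append m (e + rise s') db _ (≡ᵇ⇒≡ _ _ rank-b) ⟩
    toℕ r + rise s + 3 * m                         ≡⟨ +-swap-last (toℕ r) (rise s) (3 * m) ⟩
    toℕ r + 3 * m + rise s                         ∎
  balanced : (toℕ da + 3 * a') + (toℕ dx + 3 * x') + excess s ≡ (toℕ db + 3 * b') + (toℕ db + 3 * b') + deficit s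
  balanced = +-cancelʳ-≡ (3 * deficit s') _ _ (begin
    (toℕ da + 3 * a') + (toℕ dx + 3 * x') + excess s + 3 * deficit s'
      ≡⟨ l₁ (toℕ da) (toℕ dx) a' x' (excess s) (deficit s') ⟩
    (toℕ da + toℕ dx + excess s + 3 * deficit s') + 3 * (a' + x')
      ≡⟨ cong (_+ 3 * (a' + x')) (≡ᵇ⇒≡ (toℕ da + toℕ dx + excess s + 3 * deficit s') _ balance) ⟩
    (toℕ db + toℕ db + deficit s + 3 * excess s') + 3 * (a' + x')
      ≡⟨ l₂ (toℕ db) (deficit s) (excess s') a' x' ⟩
    (toℕ db + toℕ db + deficit s) + 3 * (a' + x' + excess s')
      ≡⟨ cong (λ z → (toℕ db + toℕ db + deficit s) + 3 * z) isAP' ⟩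
    (toℕ db + toℕ db + deficit s) + 3 * (b' + b' + deficit s')
      ≡⟨ l₃ (toℕ db) (deficit s) b' (deficit s') ⟩
    (toℕ db + 3 * b') + (toℕ db + 3 * b') + deficit s + 3 * deficit s' ∎)
    where
    l₁ : ∀ da dx a x p q → (da + 3 * a) + (dx + 3 * x) + p + 3 * q ≡ (da + dx + p + 3 * q) + 3 * (a + x)
    l₁ = solve-∀
    l₂ : ∀ db q p a x → (db + db + q + 3 * p) + 3 * (a + x) ≡ (db + db + q) + 3 * (a + x + p)
    l₂ = solve-∀
    l₃ : ∀ db q b q' → (db + db + q) + 3 * (b + b + q') ≡ (db + 3 * b) + (db + 3 * b) + q + 3 * q'
    l₃ = solve-∀

-- The rank asked for at x' is available: from  j + slack s ≤ row x  with
-- j = r + 3m and row x = ⌊(3 row x' + dx)/2⌋ the last check of Fits gives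
-- 2m + offset + slack (source) ≤ row x'.
rank-room : ∀ s dx r P → Fits s dx r P → ∀ x' m
          → toℕ r + 3 * m + slack s ≤ row (toℕ dx + 3 * x')
          → 2 * m + Plan.offset P + slack (Plan.source P) ≤ row x'
rank-room s dx r (use s' _ _ e) (_ , _ , _ , _ , room) x' m avail
  rewrite +-assoc (2 * m) e (slack s') with 2 * m + (e + slack s') ≤? row x'
... | yes enough = enough
... | no  short  = ⊥-elim (3≰2 (+-cancelˡ-≤ (n + n) 3 2 (begin
    n + n + 3                          ≤⟨ +-monoˡ-≤ 3 (≤⌊n/2⌋⇒double≤ n _ at-x) ⟩
    3 * K + toℕ dx + 3                 ≡⟨ l₁ K (toℕ dx) ⟩
    3 * suc K + toℕ dx                 ≤⟨ +-monoˡ-≤ (toℕ dx) (*-monoʳ-≤ 3 (≰⇒> short)) ⟩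
    3 * (2 * m + E) + toℕ dx           ≡⟨ l₂ m E (toℕ dx) ⟩
    6 * m + (3 * E + toℕ dx)           ≤⟨ +-monoʳ-≤ (6 * m) (≤ᵇ⇒≤ (3 * E + toℕ dx) _ room) ⟩
    6 * m + (t + t + 2)                ≡⟨ l₃ m t ⟩
    n + n + 2                          ∎)))
  where
  open ≤-Reasoning
  K = row x'
  E = e + slack s'
  t = toℕ r + slack s
  n = t + 3 * m
  at-x : n ≤ ⌊ 3 * K + toℕ dx /2⌋
  at-x = subst₂ _≤_ (+-swap-last (toℕ r) (3 * m) (slack s)) (row-step dx x') avail
  3≰2 : ¬ 3 ≤ 2
  3≰2 (s≤s (s≤s ()))
  l₁ : ∀ K d → 3 * K + d + 3 ≡ 3 * suc K + d
  l₁ = solve-∀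
  l₂ : ∀ m E d → 3 * (2 * m + E) + d ≡ 6 * m + (3 * E + d)
  l₂ = solve-∀
  l₃ : ∀ m t → 6 * m + (t + t + 2) ≡ (t + 3 * m) + (t + 3 * m) + 2
  l₃ = solve-∀

-- Weak near-APs: a genuine 3-AP below rank row x, or the trivial one a = b = x.
weak-from-ap : ∀ x → NearAPsBelow (strong ap) x → NearAPsBelow weak x
weak-from-ap x aps j j≤row with m≤n⇒m<n∨m≡n j≤row
... | inj₁ j<row with aps j (subst (_≤ row x) (sym (+-suc j 0)) j<row)
...   | a , b , ra , rb , eq , b<x = a , b , ra , rb , eq , <⇒≤ b<x
weak-from-ap x aps j j≤row | inj₂ j≡row =
  x , x , sym (trans (sym (+-identityʳ j)) j≡row) , sym j≡row , refl , ≤-refl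

AllNearAPs : ℕ → Set
AllNearAPs x = ∀ k → NearAPsBelow (strong k) x

every-shape : ∀ x → AllNearAPs x → ∀ s → NearAPsBelow s x
every-shape x all (strong k) = all k
every-shape x all weak       = weak-from-ap x (all ap)

all-near-APs : ∀ x → AllNearAPs x
all-near-APs = <-rec AllNearAPs step
  where
  step : ∀ x → (∀ {y} → y < x → AllNearAPs y) → AllNearAPs x
  step zero    _   k j avail = ⊥-elim (n≮0 (subst₂ _≤_ (+-comm j 1) (row-val3 []) avail))
  step (suc n) rec k j avail =
    subst₂ (NearAP (strong k)) (sym (decompose x)) (sym (decompose j))
      (near-lift (strong k) dx r P (plan-fits k dx r) x' m
        (every-shape x' (rec (rest<self x (s≤s z≤n))) (Plan.source P) (2 * m + Plan.offset P)
          (rank-room (strong k) dx r P (plan-fits k dx r) x' m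
            (subst₂ (λ i y → i + 1 ≤ row y) (decompose j) (decompose x) avail))))
    where
    x  = suc n
    dx = lastDigit x
    x' = x / 3
    r  = lastDigit j
    m  = j / 3
    P  = plan k dx r

ap-below : ∀ x j → j < row x → Σ ℕ λ a → Σ ℕ λ b → row a ≡ j × row b ≡ j × a + x ≡ b + b × b < x
ap-below x j j<row with all-near-APs x ap j (subst (_≤ row x) (+-comm 1 j) j<row)
... | a , b , ra , rb , eq , b<x =
  a , b , ra , trans rb (+-identityʳ j) , trans (sym (+-identityʳ (a + x))) (trans eq (+-identityʳ (b + b))) , b<x

any-witness : ∀ {A : Set} (p : A → Bool) xs → any p xs ≡ true → Σ A λ x → x ∈ xs × p x ≡ true
any-witness p xs e with find (any⁻ p xs (Equivalence.from T-≡ e))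
... | x , x∈xs , px = x , x∈xs , Equivalence.to T-≡ px

any-intro : ∀ {A : Set} (p : A → Bool) {xs x} → x ∈ xs → p x ≡ true → any p xs ≡ true
any-intro p x∈xs px = Equivalence.to T-≡ (any⁺ p (lose x∈xs (Equivalence.from T-≡ px)))

any-++ : ∀ {A : Set} (p : A → Bool) xs ys → any p (xs ++ ys) ≡ any p xs ∨ any p ys
any-++ p []       ys = refl
any-++ p (x ∷ xs) ys rewrite any-++ p xs ys = sym (∨-assoc (p x) _ _)

equal-gaps⇒ap : ∀ a b x → a ≤ b → b ≤ x → b ∸ a ≡ x ∸ b → a + x ≡ b + b
equal-gaps⇒ap a b x a≤b b≤x gaps = begin
  a + x                           ≡⟨ cong (a +_) (m+[n∸m]≡n b≤x) ⟨
  a + (b + (x ∸ b))               ≡⟨ cong (λ z → a + (b + z)) gaps ⟨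
  a + (b + (b ∸ a))               ≡⟨ cong (λ z → a + (z + (b ∸ a))) (m+[n∸m]≡n a≤b) ⟨
  a + ((a + (b ∸ a)) + (b ∸ a))   ≡⟨ regroup a (b ∸ a) ⟩
  (a + (b ∸ a)) + (a + (b ∸ a))   ≡⟨ cong₂ _+_ (m+[n∸m]≡n a≤b) (m+[n∸m]≡n a≤b) ⟩
  b + b                           ∎
  where
  open ≡-Reasoning
  regroup : ∀ a d → a + ((a + d) + d) ≡ (a + d) + (a + d)
  regroup = solve-∀

ap⇒equal-gaps : ∀ a b x → a ≤ b → b ≤ x → a + x ≡ b + b → b ∸ a ≡ x ∸ b
ap⇒equal-gaps a b x a≤b b≤x isAP = sym (+-cancelˡ-≡ (a + b) _ _ (begin
  (a + b) + (x ∸ b)    ≡⟨ +-assoc a b _ ⟩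
  a + (b + (x ∸ b))    ≡⟨ cong (a +_) (m+[n∸m]≡n b≤x) ⟩
  a + x                ≡⟨ isAP ⟩
  b + b                ≡⟨ cong (_+ b) (m+[n∸m]≡n a≤b) ⟨
  (a + (b ∸ a)) + b    ≡⟨ regroup a (b ∸ a) b ⟩
  (a + b) + (b ∸ a)    ∎))
  where
  open ≡-Reasoning
  regroup : ∀ a d b → (a + d) + b ≡ (a + b) + d
  regroup = solve-∀

makesAP-intro : ∀ L a b x → a ∈ L → b ∈ L → a < b → b < x → a + x ≡ b + b → makesAP L x ≡ true
makesAP-intro L a b x a∈L b∈L a<b b<x isAP =
  any-intro (λ u → any (λ v → (u <ᵇ v) ∧ ((v ∸ u) ≡ᵇ (x ∸ v))) L) a∈L
    (any-intro (λ v → (a <ᵇ v) ∧ ((v ∸ a) ≡ᵇ (x ∸ v))) b∈L test)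
  where
  test : (a <ᵇ b) ∧ ((b ∸ a) ≡ᵇ (x ∸ b)) ≡ true
  test rewrite Equivalence.to T-≡ (<⇒<ᵇ a<b)
             | Equivalence.to T-≡ (≡⇒≡ᵇ _ _ (ap⇒equal-gaps a b x (<⇒≤ a<b) (<⇒≤ b<x) isAP)) = refl

makesAP-elim : ∀ L x → makesAP L x ≡ true → Σ ℕ λ a → Σ ℕ λ b → a ∈ L × b ∈ L × a < b × b ∸ a ≡ x ∸ b
makesAP-elim L x e with any-witness (λ u → any (λ v → (u <ᵇ v) ∧ ((v ∸ u) ≡ᵇ (x ∸ v))) L) L e
... | a , a∈L , e' with any-witness (λ v → (a <ᵇ v) ∧ ((v ∸ a) ≡ᵇ (x ∸ v))) L e'
... | b , b∈L , test with Equivalence.to T-∧ (Equivalence.from T-≡ test)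
... | a<ᵇb , gaps = a , b , a∈L , b∈L , <ᵇ⇒< a b a<ᵇb , ≡ᵇ⇒≡ _ _ gaps

Classifies : ℕ → List (ℕ → Bool) → Set
Classifies n ps = ∀ y → any (λ p → p y) ps ≡ true ⇔ row y < n

TermsBelow : ℕ → List (ℕ → Bool) → ℕ → Set
TermsBelow n ps b = ∀ y → y ∈ termsBelow ps b ⇔ (y < b × row y ≡ n)

skip-used : ∀ ps b → any (λ p → p b) ps ≡ true → termsBelow ps (suc b) ≡ termsBelow ps b
skip-used ps b used rewrite used = refl

skip-AP : ∀ ps b → makesAP (termsBelow ps b) b ≡ true → termsBelow ps (suc b) ≡ termsBelow ps b
skip-AP ps b makes rewrite makes with any (λ p → p b) ps
... | true  = refl
... | false = refl

take : ∀ ps b → any (λ p → p b) ps ≡ false → makesAP (termsBelow ps b) b ≡ false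
     → termsBelow ps (suc b) ≡ termsBelow ps b ++ [ b ]
take ps b unused free rewrite unused | free = refl

AP-free-step : ∀ n ps b → TermsBelow n ps b → row b ≡ n → makesAP (termsBelow ps b) b ≡ false
AP-free-step n ps b terms rank with makesAP (termsBelow ps b) b in makes
... | false = refl
... | true with makesAP-elim _ b makes
... | a , a' , a∈ , a'∈ , a<a' , gaps with Equivalence.to (terms a) a∈ | Equivalence.to (terms a') a'∈
... | (_ , ra) | (a'<b , ra') =
  ⊥-elim (rank-class-AP-free b a a' (trans ra (sym rank)) (trans ra' (sym rank))
            (equal-gaps⇒ap a a' b (<⇒≤ a<a') (<⇒≤ a'<b) gaps) a<a')

AP-step : ∀ n ps b → TermsBelow n ps b → n < row b → makesAP (termsBelow ps b) b ≡ true
AP-step n ps b terms n<row with ap-below b n n<row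
... | a , a' , ra , ra' , isAP , a'<b =
  makesAP-intro _ a a' b (Equivalence.from (terms a) (<-trans a<a' a'<b , ra))
                         (Equivalence.from (terms a') (a'<b , ra')) a<a' a'<b isAP
  where
  a<a' : a < a'
  a<a' = first<middle isAP a'<b

unused : ∀ n ps → Classifies n ps → ∀ b → ¬ row b < n → any (λ p → p b) ps ≡ false
unused n ps classifies b not-below with any (λ p → p b) ps in used
... | true  = ⊥-elim (not-below (Equivalence.to (classifies b) used))
... | false = refl

widen : ∀ {y b} {P : Set} → y < b × P → y < suc b × P
widen (y<b , p) = m≤n⇒m≤1+n y<b , p

terms-below : ∀ n ps → Classifies n ps → ∀ b → TermsBelow n ps b
terms-below n ps classifies zero    y = mk⇔ (λ ()) (λ { (() , _) })
terms-below n ps classifies (suc b) with terms-below n ps classifies b | <-cmp (row b) n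
... | terms | tri< used _ _ rewrite skip-used ps b (Equivalence.from (classifies b) used) =
  λ y → mk⇔ (λ y∈ → widen (Equivalence.to (terms y) y∈))
            (λ { (y<1+b , ry) → Equivalence.from (terms y) (≤∧≢⇒< (≤-pred y<1+b) (λ { refl → <-irrefl ry used }) , ry) })
... | terms | tri≈ _ rank _ rewrite take ps b (unused n ps classifies b (λ below → <-irrefl rank below)) (AP-free-step n ps b terms rank) =
  λ y → mk⇔ (λ y∈ → old-or-b y (∈-++⁻ (termsBelow ps b) y∈))
            (λ { (y<1+b , ry) → new y y<1+b ry })
  where
  old-or-b : ∀ y → y ∈ termsBelow ps b ⊎ y ∈ [ b ] → y < suc b × row y ≡ n
  old-or-b y (inj₁ y∈)        = widen (Equivalence.to (terms y) y∈)
  old-or-b y (inj₂ (here refl)) = ≤-refl , rank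
  new : ∀ y → y < suc b → row y ≡ n → y ∈ termsBelow ps b ++ [ b ]
  new y y<1+b ry with m≤n⇒m<n∨m≡n y<1+b
  ... | inj₁ y<b    = ∈-++⁺ˡ (Equivalence.from (terms y) (≤-pred y<b , ry))
  ... | inj₂ refl   = ∈-++⁺ʳ (termsBelow ps b) (here refl)
... | terms | tri> _ _ above rewrite skip-AP ps b (AP-step n ps b terms above) =
  λ y → mk⇔ (λ y∈ → widen (Equivalence.to (terms y) y∈))
            (λ { (y<1+b , ry) → Equivalence.from (terms y) (≤∧≢⇒< (≤-pred y<1+b) (λ { refl → <-irrefl (sym ry) above }) , ry) })

memOf-rank : ∀ n ps → Classifies n ps → ∀ x → memOf ps x ≡ true ⇔ row x ≡ n
memOf-rank n ps classifies x = mk⇔ member⇒rank rank⇒member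
  where
  terms = terms-below n ps classifies (suc x)
  member⇒rank : memOf ps x ≡ true → row x ≡ n
  member⇒rank e with any-witness (λ y → y ≡ᵇ x) (termsBelow ps (suc x)) e
  ... | y , y∈ , y≡ᵇx with ≡ᵇ⇒≡ y x (Equivalence.from T-≡ y≡ᵇx)
  ... | refl = proj₂ (Equivalence.to (terms y) y∈)
  rank⇒member : row x ≡ n → memOf ps x ≡ true
  rank⇒member rank = any-intro (λ y → y ≡ᵇ x) (Equivalence.from (terms x) (≤-refl , rank))
                       (Equivalence.to T-≡ (≡⇒≡ᵇ x x refl))

prevS-classifies : ∀ n → Classifies n (prevS n)
prevS-classifies zero    y = mk⇔ (λ ()) (λ ())
prevS-classifies (suc n) y rewrite any-++ (λ p → p y) (prevS n) [ memOf (prevS n) ] =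
  mk⇔ used⇒below below⇒used
  where
  earlier = prevS-classifies n y
  latest  = memOf-rank n (prevS n) (prevS-classifies n) y
  used⇒below : any (λ p → p y) (prevS n) ∨ (memOf (prevS n) y ∨ false) ≡ true → row y < suc n
  used⇒below e with Equivalence.to T-∨ (Equivalence.from T-≡ e)
  ... | inj₁ old = m≤n⇒m≤1+n (Equivalence.to earlier (Equivalence.to T-≡ old))
  ... | inj₂ new with Equivalence.to T-∨ new
  ...   | inj₁ latest-used = ≤-reflexive (cong suc (Equivalence.to latest (Equivalence.to T-≡ latest-used)))
  below⇒used : row y < suc n → any (λ p → p y) (prevS n) ∨ (memOf (prevS n) y ∨ false) ≡ true
  below⇒used below with m≤n⇒m<n∨m≡n (≤-pred below)
  ... | inj₁ row<n rewrite Equivalence.from earlier row<n = refl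
  ... | inj₂ row≡n rewrite Equivalence.from latest row≡n = ∨-zeroʳ _

S-rank : ∀ n x → inS n x ⇔ row x ≡ n
S-rank n = memOf-rank n (prevS n) (prevS-classifies n)

theorem10 : (i x : ℕ) → (∃[ j ] val3 (G i j) ≡ x) ⇔ inS i x
theorem10 i x = ⇔-trans (grid-row i x) (⇔-sym (S-rank i x))
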